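{- If $\mathsf{P}\in\mathbb{P}_{\mathrm{fin}}$, then $\mathcal{A}_\mathsf{P}\in D_\omega(\mathbf{\Sigma}^0_1)(\mathcal{P}\omega)$.
   Context: Scott domain: $\mathcal{P}\omega$ is the power set of $\omega$ with topology generated by $\mathcal{O}_F=\{x\subseteq\omega\mid F\subseteq x\}$, $F$ finite. $D_\omega(\mathbf{\Sigma}^0_1)(\mathcal{P}\omega)$ is the class of sets $\bigcup\{A_n\setminus\bigcup_{m<n}A_m \mid n \text{ odd}\}$ with $(A_n)_{n<\omega}$ open subsets of $\mathcal{P}\omega$. A 2-colored poset is $\mathsf{P}=(P,\leq_p,\mathrm{col}_p)$, $\mathrm{col}_p:P\to\{0,1\}$. $\cdot\rightarrowtail_c\cdot$ denotes existence of an injective order- and color-preserving map sending immediate predecessors to immediate predecessors. A countable poset is a shrub if (1) there is no injective order-preserving map from $(\omega,\leq)$ into it; (2) every element has finitely many elements below it; (3) it has a minimal element $\bot$; (4) every subset with an upper bound has a least upper bound. $\mathbb{P}_{\mathrm{lay}}$ is the class of countable 2-colored posets whose underlying poset is a shrub, with $\mathrm{col}(\bot)=0$, every maximal element of color $1$, and none of $\vee^0_1$ ($a<b$, $a<c$, $b\perp c$, colors $1,0,0$), $\wedge^1_0$ ($a<c$, $b<c$, $a\perp b$, $\mathrm{col}(c)=1$, $\mathrm{col}(a)=\mathrm{col}(b)=0$), $\mid^1_1$ ($a<b$ both color 1) satisfying $\cdot\rightarrowtail_c\mathsf{P}$. $\mathbb{P}_{\mathrm{fin}}$ is the class of $\mathsf{P}\in\mathbb{P}_{\mathrm{lay}}$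 such that every $p\neq\bot$ has finitely many $p'$ with $p\leq_p p'$. $\mathcal{A}_\mathsf{P}$: identify $P$ with some $\alpha\in\omega\cup\{\omega\}$, set $l_p(\bot)=\emptyset$, $l_p(n)=\{k\in P\mid k\leq_p n\}$ for $n\neq\bot$, and $\mathcal{A}_\mathsf{P}=\{l_p(p)\mid \mathrm{col}_p(p)=1\}$. -}

module Defs where

open import Data.Nat using (ℕ; zero; suc; _+_; _*_; _<_; _≤_)
open import Data.Fin using (Fin; toℕ) renaming (zero to f0; suc to fs)
open import Data.Bool using (Bool; true; false)
open import Data.List using (List)
open import Data.List.Membership.Propositional using (_∈_)
open import Data.Product using (Σ; ∃; _×_; _,_)
open import Data.Sum using (_⊎_)
open import Relation.Nullary using (¬_)
open import Relation.Binary.PropositionalEquality using (_≡_; _≢_)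
open import Relation.Binary.Structures using (IsPartialOrder)
open import Function.Definitions using (Injective)
open import Function.Bundles using (_⇔_)

-- Cardinals α ∈ ω ∪ {ω}; a countable poset is identified with α.

data Card : Set where
  fin : ℕ → Card
  omega : Card

El : Card → Set
El (fin n) = Fin n
El omega = ℕ

toN : (α : Card) → El α → ℕ
toN (fin n) i = toℕ i
toN omega k = k

-- Raw 2-colored ordered structures (colour true = 1, false = 0)

record Raw2 : Set₁ where
  field
    Car : Set
    _≼_ : Car → Car → Set
    col : Car → Bool

module _ (R : Raw2) where
  open Raw2 R

  _≺_ : Car → Car → Set
  a ≺ b = (a ≼ b) × (a ≢ b)

  ImmPred : Car → Car → Set
  ImmPred a b = (a ≺ b) × ¬ (Σ Car λ c → (a ≺ c) × (c ≺ b))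

_↣c_ : Raw2 → Raw2 → Set
Q ↣c P =
  Σ (Raw2.Car Q → Raw2.Car P) λ f →
    Injective _≡_ _≡_ f
    × (∀ a b → Raw2._≼_ Q a b → Raw2._≼_ P (f a) (f b))
    × (∀ a → Raw2.col P (f a) ≡ Raw2.col Q a)
    × (∀ a b → ImmPred Q a b → ImmPred P (f a) (f b))

record CPoset : Set₁ where
  field
    card : Card
    _≤p_ : El card → El card → Set
    isPO : IsPartialOrder _≡_ _≤p_
    colp : El card → Bool

  raw : Raw2
  raw = record { Car = El card ; _≼_ = _≤p_ ; col = colp }

-- ∨⁰₁ : a < b, a < c, b ⊥ c ; colours 1,0,0   (a = 0, b = 1, c = 2)
vee : Raw2
vee = record
  { Car = Fin 3
  ; _≼_ = λ x y → (x ≡ y) ⊎ (x ≡ f0)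
  ; col = λ { f0 → true ; (fs _) → false }
  }

-- ∧¹₀ : a < c, b < c, a ⊥ b ; col c = 1, col a = col b = 0  (a=0,b=1,c=2)
wedge : Raw2
wedge = record
  { Car = Fin 3
  ; _≼_ = λ x y → (x ≡ y) ⊎ (y ≡ fs (fs f0))
  ; col = λ { (fs (fs f0)) → true ; _ → false }
  }

-- |¹₁ : a < b, both colour 1  (a = 0, b = 1)
bar : Raw2
bar = record
  { Car = Fin 2
  ; _≼_ = λ x y → (x ≡ y) ⊎ (y ≡ fs f0)
  ; col = λ _ → true
  }

module _ (P : CPoset) where
  open CPoset P

  IsLeast : El card → Set
  IsLeast b = ∀ x → b ≤p x

  IsMaximal : El card → Set
  IsMaximal p = ∀ q → p ≤p q → q ≡ p

  UpperBound : (El card → Set) → El card → Set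
  UpperBound S u = ∀ s → S s → s ≤p u

  record Shrub : Set₁ where
    field
      noOmegaChain : ¬ (Σ (ℕ → El card) λ f →
                          Injective _≡_ _≡_ f × (∀ m n → m ≤ n → f m ≤p f n))
      finBelow : ∀ p → Σ (List (El card)) λ xs → ∀ q → q ≤p p → q ∈ xs
      bot : El card
      bot-least : IsLeast bot
      lub : (S : El card → Set) → Σ (El card) (UpperBound S) →
            Σ (El card) λ l → UpperBound S l × (∀ u → UpperBound S u → l ≤p u)

  InPlay : Set₁
  InPlay = Σ Shrub λ sh →
      colp (Shrub.bot sh) ≡ false
    × (∀ p → IsMaximal p → colp p ≡ true)
    × ¬ (vee ↣c raw)
    × ¬ (wedge ↣c raw)
    × ¬ (bar ↣c raw)

  InPfin : Set₁
  InPfin = Σ InPlay λ pl →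
    ∀ p → p ≢ Shrub.bot (Data.Product.proj₁ pl) →
      Σ (List (El card)) λ xs → ∀ q → p ≤p q → q ∈ xs

  -- l_p(p) as a subset of ω: ∅ for p = ⊥, {k ∈ P | k ≤p p} otherwise
  lp : El card → ℕ → Set
  lp p k = ¬ IsLeast p × Σ (El card) λ q → (toN card q ≡ k) × (q ≤p p)

-- The Scott domain Pω (subsets of ω as characteristic functions)

Pω : Set
Pω = ℕ → Bool

PSet : Set₁
PSet = Pω → Set

O : List ℕ → PSet
O F x = ∀ k → k ∈ F → x k ≡ true

IsOpen : PSet → Set
IsOpen U = ∀ x → U x → Σ (List ℕ) λ F → O F x × (∀ y → O F y → U y)

Odd : ℕ → Set
Odd n = Σ ℕ λ k → n ≡ suc (2 * k)

InDω : PSet → Set₁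
InDω S = Σ (ℕ → PSet) λ A →
    (∀ n → IsOpen (A n))
  × (∀ x → S x ⇔ (Σ ℕ λ n → Odd n × A n x × (∀ m → m < n → ¬ A m x)))

𝒜 : CPoset → PSet
𝒜 P x = Σ (El (CPoset.card P)) λ p →
  (CPoset.colp P p ≡ true) × (∀ k → (x k ≡ true) ⇔ lp P p k)

-- Give every p ≠ ⊥ the rank N(p) = #{q | p ≤ q}, finite since P ∈ ℙ_fin; it strictly
-- decreases along <, so along proper inclusions l(p) ⊊ l(q).  Let A_n be the union of
-- the O_F such that either F = l(p) with col(p) = 1 and 2N(p)+1 ≤ n, or 2N(q)+2 ≤ n for
-- every q of colour 1 with F ⊆ l(q).  Then x = l(p) enters the A_n at stage 2N(p)+1 and
-- not earlier, while a set entering at an odd stage 2j+1 through some l(p) ⊆ x is equal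
-- to it: any k ∈ x ∖ l(p) would give F = l(p) ∪ {k}, which is in A_{2j} already.
-- Only finiteness of down- and up-sets, col(⊥) = 0 and least upper bounds (to decide ≤)
-- are used.
module Submission where

open import Defs
open import Level using (0ℓ)
open import Data.Nat using (ℕ; zero; suc; _+_; _*_; _<_; _≤_; _<?_; s≤s; s≤s⁻¹; z≤n)
import Data.Nat as ℕ
open import Data.Nat.Properties hiding (_≤?_)
open import Data.Fin using (fromℕ<)
import Data.Fin as Fin
open import Data.Fin.Properties using (toℕ-injective; toℕ<n; toℕ-fromℕ<)
open import Data.Bool using (true)
open import Data.List using (List; _∷_; map; filter)
open import Data.List.Extrema.Nat using (max; xs≤max)
import Data.List.Relation.Unary.All as All
open import Data.List.Relation.Unary.Any using (here; there)
open import Data.List.Membership.Propositional using (_∈_)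
open import Data.List.Membership.Propositional.Properties using (∈-map⁺; ∈-map⁻; ∈-filter⁺; ∈-filter⁻)
open import Data.List.Membership.DecPropositional ℕ._≟_ using (_∈?_)
open import Data.Product using (Σ; _×_; _,_; proj₁; proj₂)
open import Data.Sum using (_⊎_; inj₁; inj₂)
open import Data.Empty using (⊥-elim)
open import Relation.Nullary using (¬_; Dec; yes; no)
open import Relation.Nullary.Decidable using (map′)
open import Relation.Unary using (Pred; Decidable; _⊆_)
open import Relation.Binary.Definitions using (DecidableEquality)
open import Relation.Binary.PropositionalEquality
open import Relation.Binary.Structures using (IsPartialOrder)
open import Function using (_∘_; _∘′_)
open import Function.Definitions using (Injective)
open import Function.Bundles using (_⇔_; mk⇔; Equivalence)

open Equivalence

≤-half : ∀ {a b} → 2 * a ≤ suc (2 * b) → a ≤ b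
≤-half {a} {b} h = s≤s⁻¹ (*-cancelˡ-< 2 a (suc b) (begin-strict
  2 * a          ≤⟨ h ⟩
  suc (2 * b)    <⟨ n<1+n _ ⟩
  2 + 2 * b      ≡⟨ *-suc 2 b ⟨
  2 * suc b      ∎))
  where open ≤-Reasoning

count : {P : Pred ℕ 0ℓ} → Decidable P → ℕ → ℕ
count P? zero = 0
count P? (suc n) with P? n
... | yes _ = suc (count P? n)
... | no _  = count P? n

BoundedBy : Pred ℕ 0ℓ → ℕ → Set
BoundedBy P m = ∀ {k} → P k → k < m

module _ {P Q : Pred ℕ 0ℓ} (P? : Decidable P) (Q? : Decidable Q) (P⊆Q : P ⊆ Q) where

  count-mono : ∀ n → count P? n ≤ count Q? n
  count-mono zero = z≤n
  count-mono (suc n) with P? n | Q? n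
  ... | yes _ | yes _  = s≤s (count-mono n)
  ... | yes p | no ¬q  = ⊥-elim (¬q (P⊆Q p))
  ... | no _  | yes _  = m≤n⇒m≤1+n (count-mono n)
  ... | no _  | no _   = count-mono n

  count-mono-< : ∀ {j} → Q j → ¬ P j → ∀ {n} → j < n → count P? n < count Q? n
  count-mono-< {j} qj ¬pj {suc n} (s≤s j≤n) with P? n | Q? n
  ... | yes p | yes _  = s≤s (count-mono-< qj ¬pj (≤∧≢⇒< j≤n λ { refl → ¬pj p }))
  ... | yes p | no ¬q  = ⊥-elim (¬q (P⊆Q p))
  ... | no _  | yes _  = s≤s (count-mono n)
  ... | no _  | no ¬q  = count-mono-< qj ¬pj (≤∧≢⇒< j≤n λ { refl → ¬q qj })

count-stable : {P : Pred ℕ 0ℓ} (P? : Decidable P) → ∀ {m n} →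
               BoundedBy P m → m ≤ n → count P? n ≡ count P? m
count-stable P? {m} {n} bounded m≤n with m≤n⇒m<n∨m≡n m≤n
... | inj₂ refl = refl
count-stable P? {m} {suc n} bounded m≤n | inj₁ (s≤s m≤n′) with P? n
... | yes p = ⊥-elim (<⇒≱ (bounded p) m≤n′)
... | no _  = count-stable P? bounded m≤n′

module _ {P Q : Pred ℕ 0ℓ} (P? : Decidable P) (Q? : Decidable Q)
         {m n} (P<m : BoundedBy P m) (Q<n : BoundedBy Q n) (P⊆Q : P ⊆ Q) where

  private
    count-both : count P? (m + n) ≡ count P? m × count Q? (m + n) ≡ count Q? n
    count-both = count-stable P? P<m (m≤m+n m n) , count-stable Q? Q<n (m≤n+m n m)

  count-≤ : count P? m ≤ count Q? n
  count-≤ = subst₂ _≤_ (proj₁ count-both) (proj₂ count-both) (count-mono P? Q? P⊆Q (m + n))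

  count-< : ∀ {j} → Q j → ¬ P j → count P? m < count Q? n
  count-< qj ¬pj = subst₂ _<_ (proj₁ count-both) (proj₂ count-both)
    (count-mono-< P? Q? P⊆Q qj ¬pj (<-≤-trans (Q<n qj) (m≤n+m n m)))

InDω-cong : {S T : PSet} → (∀ x → S x ⇔ T x) → InDω S → InDω T
InDω-cong S⇔T (A , A-open , S⇔first) =
  A , A-open , λ x → mk⇔ (to (S⇔first x) ∘′ from (S⇔T x))
                         (to (S⇔T x) ∘′ from (S⇔first x))

_≐_ : Pω → Pred ℕ 0ℓ → Set
x ≐ S = ∀ k → (x k ≡ true) ⇔ S k

module RankedFiniteFamily
  {I : Set} (L : I → Pred ℕ 0ℓ)
  (L-finite : ∀ i → Σ (List ℕ) λ F → ∀ k → k ∈ F ⇔ L i k)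
  (rank : I → ℕ)
  (rank-antitone : ∀ i j → L i ⊆ L j → rank j ≤ rank i)
  (rank-strict : ∀ i j {k} → L i ⊆ L j → L j k → ¬ L i k → rank j < rank i)
  where

  Admissible : ℕ → List ℕ → Set
  Admissible n F = (Σ I λ i → (∀ k → k ∈ F ⇔ L i k) × suc (2 * rank i) ≤ n)
                 ⊎ (∀ i → (∀ {k} → k ∈ F → L i k) → 2 * suc (rank i) ≤ n)

  A : ℕ → PSet
  A n x = Σ (List ℕ) λ F → O F x × Admissible n F

  A-open : ∀ n → IsOpen (A n)
  A-open n x (F , xF , adm) = F , xF , λ y yF → F , yF , adm

  FirstOdd : PSet
  FirstOdd x = Σ ℕ λ n → Odd n × A n x × (∀ m → m < n → ¬ A m x)

  enters : ∀ {x i} → x ≐ L i → A (suc (2 * rank i)) x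
  enters {x} {i} x≐Li =
    F , (λ k k∈F → from (x≐Li k) (to (F≐Li k) k∈F)) , inj₁ (i , F≐Li , ≤-refl)
    where open Σ (L-finite i) renaming (proj₁ to F; proj₂ to F≐Li)

  not-before : ∀ {x i m} → x ≐ L i → m < suc (2 * rank i) → ¬ A m x
  not-before {x} {i} x≐Li m<n (F , xF , inj₁ (i′ , F≐Li′ , n′≤m)) =
    <⇒≱ m<n (≤-trans (s≤s (*-monoʳ-≤ 2 (rank-antitone i′ i Li′⊆Li))) n′≤m)
    where
    Li′⊆Li : L i′ ⊆ L i
    Li′⊆Li {k} l = to (x≐Li k) (xF k (from (F≐Li′ k) l))
  not-before {x} {i} x≐Li m<n (F , xF , inj₂ above) =
    <⇒≱ (≤-<-trans (s≤s⁻¹ m<n) (*-monoʳ-< 2 (n<1+n (rank i))))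
        (above i λ {k} k∈F → to (x≐Li k) (xF k k∈F))

  first-odd : ∀ {x i} → x ≐ L i → FirstOdd x
  first-odd {i = i} x≐Li = _ , (rank i , refl) , enters x≐Li , λ m m<n → not-before x≐Li m<n

  first-odd⁻¹ : ∀ {x} → FirstOdd x → Σ I λ i → x ≐ L i
  first-odd⁻¹ (_ , (j , refl) , (F , xF , inj₂ above) , first) =
    ⊥-elim (first (2 * j) ≤-refl (F , xF , inj₂ λ i F⊆Li →
      *-monoʳ-≤ 2 (≤-half {suc (rank i)} {j} (above i F⊆Li))))
  first-odd⁻¹ {x} (_ , (j , refl) , (F , xF , inj₁ (i , F≐Li , n≤2j+1)) , first) =
    i , λ k → mk⇔ (x⇒L k) (λ l → xF k (from (F≐Li k) l))
    where
    rank≤j : rank i ≤ j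
    rank≤j = *-cancelˡ-≤ 2 (s≤s⁻¹ n≤2j+1)

    x⇒L : ∀ k → x k ≡ true → L i k
    x⇒L k xk with k ∈? F
    ... | yes k∈F = to (F≐Li k) k∈F
    ... | no  k∉F = ⊥-elim (first (2 * j) ≤-refl (k ∷ F , xkF , inj₂ above))
      where
      xkF : O (k ∷ F) x
      xkF _ (here refl) = xk
      xkF k′ (there k′∈F) = xF k′ k′∈F

      above : ∀ i′ → (∀ {k′} → k′ ∈ k ∷ F → L i′ k′) → 2 * suc (rank i′) ≤ 2 * j
      above i′ kF⊆Li′ = *-monoʳ-≤ 2 (≤-trans
        (rank-strict i i′ (λ {k′} l → kF⊆Li′ (there (from (F≐Li k′) l))) (kF⊆Li′ (here refl))
                     (k∉F ∘ from (F≐Li k)))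
        rank≤j)

  InDω-family : InDω (λ x → Σ I λ i → x ≐ L i)
  InDω-family = A , A-open , λ x → mk⇔ (λ (i , x≐Li) → first-odd x≐Li) first-odd⁻¹

_≟ᴱ_ : {α : Card} → DecidableEquality (El α)
_≟ᴱ_ {fin n} = Fin._≟_
_≟ᴱ_ {omega} = ℕ._≟_

toN-injective : ∀ α → Injective _≡_ _≡_ (toN α)
toN-injective (fin n) = toℕ-injective
toN-injective omega e = e

isCode? : ∀ α k → Dec (Σ (El α) λ q → toN α q ≡ k)
isCode? (fin n) k with k <? n
... | yes k<n = yes (fromℕ< k<n , toℕ-fromℕ< k<n)
... | no  k≮n = no λ { (q , refl) → k≮n (toℕ<n q) }
isCode? omega k = yes (k , refl)

-- lp P p k is definitionally ¬ IsLeast P p × Codes card (_≤p p) k.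
Codes : ∀ α → Pred (El α) 0ℓ → Pred ℕ 0ℓ
Codes α S k = Σ (El α) λ q → toN α q ≡ k × S q

module _ (α : Card) {S : Pred (El α) 0ℓ} where

  code∈Codes : ∀ {q} → S q → Codes α S (toN α q)
  code∈Codes s = _ , refl , s

  Codes-code : ∀ {q} → Codes α S (toN α q) → S q
  Codes-code (q′ , e , s) = subst S (toN-injective α e) s

  Codes? : Decidable S → Decidable (Codes α S)
  Codes? S? k with isCode? α k
  ... | no ¬code = no λ { (q , e , _) → ¬code (q , e) }
  ... | yes (q , refl) = map′ code∈Codes Codes-code (S? q)

  module _ (xs : List (El α)) (S⊆xs : ∀ q → S q → q ∈ xs) where

    Codes-bounded : BoundedBy (Codes α S) (suc (max 0 (map (toN α) xs)))
    Codes-bounded (q , refl , s) =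
      s≤s (All.lookup (xs≤max 0 (map (toN α) xs)) (∈-map⁺ (toN α) (S⊆xs q s)))

    Codes-list : Decidable S → Σ (List ℕ) λ F → ∀ k → k ∈ F ⇔ Codes α S k
    Codes-list S? = map (toN α) (filter S? xs) , λ k → mk⇔ listed⇒code code⇒listed
      where
      listed⇒code : ∀ {k} → k ∈ map (toN α) (filter S? xs) → Codes α S k
      listed⇒code k∈ with ∈-map⁻ (toN α) k∈
      ... | q , q∈ , refl = q , refl , proj₂ (∈-filter⁻ S? {xs = xs} q∈)

      code⇒listed : ∀ {k} → Codes α S k → k ∈ map (toN α) (filter S? xs)
      code⇒listed (q , refl , s) = ∈-map⁺ (toN α) (∈-filter⁺ S? (S⊆xs q s) s)

module _ (P : CPoset) where
  open CPoset P
  private module ≤ = IsPartialOrder isPO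

  -- The least upper bound of {q} ∩ ↓p is q exactly when q ≤ p.
  ≤-decidable-by-lub : Shrub P → ∀ q p → Dec (q ≤p p)
  ≤-decidable-by-lub sh q p with Shrub.lub sh (λ s → s ≡ q × s ≤p p) (p , λ _ → proj₂)
  ... | l , l-ub , l-least with l ≟ᴱ q
  ...   | yes refl = yes (l-least p λ _ → proj₂)
  ...   | no  l≢q  = no λ q≤p →
    l≢q (≤.antisym (l-least q λ { _ (refl , _) → ≤.refl }) (l-ub q (refl , q≤p)))

module Pfin (P : CPoset) (pf : InPfin P) where
  open CPoset P
  private module ≤ = IsPartialOrder isPO

  private
    sh : Shrub P
    sh = proj₁ (proj₁ pf)

  open Shrub sh using (bot; bot-least; finBelow)

  _≤?_ : ∀ q p → Dec (q ≤p p)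
  _≤?_ = ≤-decidable-by-lub P sh

  colour1⇒≢bot : ∀ {p} → colp p ≡ true → p ≢ bot
  colour1⇒≢bot c refl with trans (sym c) (proj₁ (proj₂ (proj₁ pf)))
  ... | ()

  ≢bot⇒¬least : ∀ {p} → p ≢ bot → ¬ IsLeast P p
  ≢bot⇒¬least p≢bot least = p≢bot (≤.antisym (least bot) (bot-least _))

  Above : El card → Pred ℕ 0ℓ
  Above p = Codes card (p ≤p_)

  Above? : ∀ p → Decidable (Above p)
  Above? p = Codes? card (p ≤?_)

  Above-bound : ∀ p → p ≢ bot → ℕ
  Above-bound p p≢bot = suc (max 0 (map (toN card) (proj₁ (proj₂ pf p p≢bot))))

  Above-bounded : ∀ p p≢bot → BoundedBy (Above p) (Above-bound p p≢bot)
  Above-bounded p p≢bot = Codes-bounded card _ (proj₂ (proj₂ pf p p≢bot))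

  Above-antitone : ∀ {p q} → p ≤p q → Above q ⊆ Above p
  Above-antitone p≤q (r , e , q≤r) = r , e , ≤.trans p≤q q≤r

  rank : ∀ p → p ≢ bot → ℕ
  rank p p≢bot = count (Above? p) (Above-bound p p≢bot)

  rank-antitone : ∀ {p q} p≢bot q≢bot → p ≤p q → rank q q≢bot ≤ rank p p≢bot
  rank-antitone {p} {q} p≢bot q≢bot p≤q =
    count-≤ (Above? q) (Above? p) (Above-bounded q q≢bot) (Above-bounded p p≢bot) (Above-antitone p≤q)

  rank-strict : ∀ {p q} p≢bot q≢bot → p ≤p q → p ≢ q → rank q q≢bot < rank p p≢bot
  rank-strict {p} {q} p≢bot q≢bot p≤q p≢q =
    count-< (Above? q) (Above? p) (Above-bounded q q≢bot) (Above-bounded p p≢bot) (Above-antitone p≤q)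
      (code∈Codes card ≤.refl) (λ q≤p → p≢q (≤.antisym p≤q (Codes-code card q≤p)))

  lp-self : ∀ {p} → p ≢ bot → lp P p (toN card p)
  lp-self p≢bot = ≢bot⇒¬least p≢bot , code∈Codes card ≤.refl

  lp-⊆⇒≤ : ∀ {p q} → p ≢ bot → lp P p ⊆ lp P q → p ≤p q
  lp-⊆⇒≤ p≢bot lp⊆lq = Codes-code card (proj₂ (lp⊆lq (lp-self p≢bot)))

  lp-finite : ∀ {p} → p ≢ bot → Σ (List ℕ) λ F → ∀ k → k ∈ F ⇔ lp P p k
  lp-finite {p} p≢bot with Codes-list card (proj₁ (finBelow p)) (proj₂ (finBelow p)) (_≤? p)
  ... | F , F≐below = F , λ k → mk⇔ (λ k∈F → ≢bot⇒¬least p≢bot , to (F≐below k) k∈F)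
                                   (λ (_ , below) → from (F≐below k) below)

  Colour1 : Set
  Colour1 = Σ (El card) λ p → colp p ≡ true

  Colour1≢bot : ((p , _) : Colour1) → p ≢ bot
  Colour1≢bot (_ , c) = colour1⇒≢bot c

  lp₁ : Colour1 → Pred ℕ 0ℓ
  lp₁ (p , _) = lp P p

  rank₁ : Colour1 → ℕ
  rank₁ i = rank (proj₁ i) (Colour1≢bot i)

  rank₁-antitone : ∀ i j → lp₁ i ⊆ lp₁ j → rank₁ j ≤ rank₁ i
  rank₁-antitone i j li⊆lj =
    rank-antitone (Colour1≢bot i) (Colour1≢bot j) (lp-⊆⇒≤ (Colour1≢bot i) li⊆lj)

  rank₁-strict : ∀ i j {k} → lp₁ i ⊆ lp₁ j → lp₁ j k → ¬ lp₁ i k → rank₁ j < rank₁ i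
  rank₁-strict i j li⊆lj ljk ¬lik =
    rank-strict (Colour1≢bot i) (Colour1≢bot j) (lp-⊆⇒≤ (Colour1≢bot i) li⊆lj)
      λ { refl → ¬lik ljk }

  open RankedFiniteFamily lp₁ (lp-finite ∘ Colour1≢bot) rank₁ rank₁-antitone rank₁-strict
    public using (InDω-family)

  lp-family⇔𝒜 : ∀ x → (Σ Colour1 λ i → x ≐ lp₁ i) ⇔ 𝒜 P x
  lp-family⇔𝒜 x = mk⇔ (λ ((p , c) , x≐lp) → p , c , x≐lp)
                      (λ (p , c , x≐lp) → (p , c) , x≐lp)

proposition33 : (P : CPoset) → InPfin P → InDω (𝒜 P)
proposition33 P pf = InDω-cong (Pfin.lp-family⇔𝒜 P pf) (Pfin.InDω-family P pf)
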